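{- Let $G_c=(V_c,E_c)$ be a connected simple undirected graph with vertices $V_c=\{v_1,\dots,v_{n_c}\}$. Construct the gadget graph $G_g=(V_g,E_g)$ by replacing every edge of $G_c$ by a path of length $3$ (with two new interior vertices) and, for every pair of distinct non-adjacent vertices of $G_c$, adding a path of length $2$ between them (with one new interior vertex), all new vertices being distinct and enumerated so that $V_g=\{v_1,\dots,v_{n_c},v_{n_c+1},\dots,v_{n_g}\}$. Let $n=n_g+1$ and define the $n\times n$ matrix $D$ by $D_{ij}=d_{G_g}(v_i,v_j)$ for $i,j\in[n_g]$, $D_{in}=D_{ni}=2$ for $i\in[n_c]$, $D_{in}=D_{ni}=3$ for $i\in[n_g]\setminus[n_c]$, and $D_{nn}=0$. Then $D$ is a distance matrix.
   Context: $[n]=\{1,\dots,n\}$; $d_{G_g}$ is the shortest-path distance in $G_g$. An $n\times n$ matrix $D$ with non-negative integer entries is a distance matrix if (i) all diagonal entries are $0$ and all off-diagonal entries are strictly positive, (ii) $D$ is symmetric, and (iii) $D_{iw}+D_{wj}\ge D_{ij}$ for all $i,j,w\in[n]$. -}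

module Defs where

open import Data.Nat using (ℕ; zero; suc; _≤_; _<_; _<ᵇ_; _+_)
open import Data.Fin using (Fin; toℕ)
open import Data.Bool using (Bool; true; false; T; not; if_then_else_)
open import Data.Maybe using (Maybe; just; nothing)
open import Data.Product using (_×_; Σ)
open import Data.Sum using (_⊎_)
open import Relation.Binary.PropositionalEquality using (_≡_)
open import Relation.Nullary using (¬_)

data Walk {V : Set} (R : V → V → Set) : V → V → ℕ → Set where
  nil  : ∀ {u} → Walk R u u 0
  cons : ∀ {u w v k} → R u w → Walk R w v k → Walk R u v (suc k)

IsShortestPathDistance : {V : Set} → (V → V → Set) → (V → V → ℕ) → Set
IsShortestPathDistance {V} R d =
  (u v : V) → Walk R u v (d u v) × ((k : ℕ) → Walk R u v k → d u v ≤ k)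

record SimpleGraph (nc : ℕ) : Set where
  field
    adj       : Fin nc → Fin nc → Bool
    adj-sym   : (i j : Fin nc) → adj i j ≡ adj j i
    adj-irrefl : (i : Fin nc) → adj i i ≡ false

  Adj : Fin nc → Fin nc → Set
  Adj i j = T (adj i j)

Connected : {nc : ℕ} → SimpleGraph nc → Set
Connected {nc} G = (i j : Fin nc) → Σ ℕ (λ k → Walk (SimpleGraph.Adj G) i j k)

-- Unordered pairs {i,j} of distinct vertices of G_c
-- are represented by i < j.
--   orig i        : the original vertex v_i
--   sub₁ i j _ _  : interior vertex of the 3-path replacing edge {i,j}, adjacent to v_i
--   sub₂ i j _ _  : interior vertex of that 3-path adjacent to v_j
--   mid i j _ _   : interior vertex of the 2-path between non-adjacent v_i, v_j
module Gadget {nc : ℕ} (G : SimpleGraph nc) where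
  open SimpleGraph G

  Lt : Fin nc → Fin nc → Set
  Lt i j = T (toℕ i <ᵇ toℕ j)

  data GV : Set where
    orig : Fin nc → GV
    sub₁ : (i j : Fin nc) → Lt i j → T (adj i j) → GV
    sub₂ : (i j : Fin nc) → Lt i j → T (adj i j) → GV
    mid  : (i j : Fin nc) → Lt i j → T (not (adj i j)) → GV

  data Edge : GV → GV → Set where
    e-in  : ∀ i j p q → Edge (orig i) (sub₁ i j p q)
    e-mid : ∀ i j p q → Edge (sub₁ i j p q) (sub₂ i j p q)
    e-out : ∀ i j p q → Edge (sub₂ i j p q) (orig j)
    m-in  : ∀ i j p q → Edge (orig i) (mid i j p q)
    m-out : ∀ i j p q → Edge (mid i j p q) (orig j)

  AdjG : GV → GV → Set
  AdjG u v = Edge u v ⊎ Edge v u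

  -- The vertex v_n (n = n_g + 1) is represented by nothing.
  isOrig : GV → Bool
  isOrig (orig _) = true
  isOrig _        = false

  Dmat : (GV → GV → ℕ) → Maybe GV → Maybe GV → ℕ
  Dmat d (just u) (just v) = d u v
  Dmat d (just u) nothing  = if isOrig u then 2 else 3
  Dmat d nothing  (just v) = if isOrig v then 2 else 3
  Dmat d nothing  nothing  = 0

IsDistanceMatrix : {A : Set} → (A → A → ℕ) → Set
IsDistanceMatrix {A} D =
  ((i : A) → D i i ≡ 0)
  × ((i j : A) → ¬ i ≡ j → 0 < D i j)
  × ((i j : A) → D i j ≡ D j i)
  × ((i j w : A) → D i j ≤ D i w + D w j)

{-# OPTIONS --safe #-}
module Submission where

-- Shortest-path distances of the gadget graph already form a metric d, and D is the cone
-- over d with apex at height h u ∈ {2, 3}.  A cone is a metric as soon as h is positive,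
-- 1-Lipschitz and d u v ≤ h u + h v.  Here h is 1-Lipschitz because it only takes the
-- values 2 and 3; and every vertex lies within h u − 2 of an original vertex, while any
-- two original vertices are joined by a 2- or 3-path, so d u v ≤ (h u − 2) + 3 + (h v − 2).

open import Defs
open import Data.Nat using (ℕ; suc; _+_; _≤_; _<_; z≤n; s≤s)
open import Data.Nat.Properties
open import Data.Fin using (toℕ)
open import Data.Fin.Properties using (toℕ-injective)
open import Data.Bool using (true; false; T; not; if_then_else_)
open import Data.Bool.Properties using (T-≡; T-not-≡)
open import Data.Empty using (⊥-elim)
open import Data.Maybe using (Maybe; just; nothing)
open import Data.Product using (_×_; _,_; proj₁; proj₂; ∃-syntax)
open import Data.Sum using (inj₁; inj₂; swap)
open import Function.Bundles using (Equivalence)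
open import Relation.Binary.Definitions using (Symmetric; tri<; tri≈; tri>)
open import Relation.Binary.PropositionalEquality using (_≡_; refl; sym; trans; cong; cong₂; subst; subst₂)
open import Relation.Nullary using (¬_)

module WalkOps {V : Set} {R : V → V → Set} where

  infixr 5 _++_

  _++_ : ∀ {u w v k m} → Walk R u w k → Walk R w v m → Walk R u v (k + m)
  nil      ++ q = q
  cons r p ++ q = cons r (p ++ q)

  _∷ʳ_ : ∀ {u w v k} → Walk R u w k → R w v → Walk R u v (suc k)
  nil      ∷ʳ r′ = cons r′ nil
  cons r p ∷ʳ r′ = cons r (p ∷ʳ r′)

  reverse : Symmetric R → ∀ {u v k} → Walk R u v k → Walk R v u k
  reverse sym-R nil        = nil
  reverse sym-R (cons r p) = reverse sym-R p ∷ʳ sym-R r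

  walk-length-pos : ∀ {u v k} → Walk R u v k → ¬ u ≡ v → 0 < k
  walk-length-pos nil        u≢v = ⊥-elim (u≢v refl)
  walk-length-pos (cons _ _) _   = s≤s z≤n

open WalkOps

module ShortestPath {V : Set} {R : V → V → Set} {d : V → V → ℕ}
                    (sp : IsShortestPathDistance R d) where

  geodesic : ∀ u v → Walk R u v (d u v)
  geodesic u v = proj₁ (sp u v)

  shortest : ∀ {u v k} → Walk R u v k → d u v ≤ k
  shortest {u} {v} = proj₂ (sp u v) _

  isDistanceMatrix : Symmetric R → IsDistanceMatrix d
  isDistanceMatrix sym-R = diagonal , positive , symmetric , triangle
    where
    diagonal : ∀ u → d u u ≡ 0
    diagonal u = n≤0⇒n≡0 (shortest nil)

    positive : ∀ u v → ¬ u ≡ v → 0 < d u v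
    positive u v = walk-length-pos (geodesic u v)

    symmetric : ∀ u v → d u v ≡ d v u
    symmetric u v = ≤-antisym (shortest (reverse sym-R (geodesic v u)))
                              (shortest (reverse sym-R (geodesic u v)))

    triangle : ∀ u v w → d u v ≤ d u w + d w v
    triangle u v w = shortest (geodesic u w ++ geodesic w v)

IsDistanceMatrix-resp : {A : Set} {D D′ : A → A → ℕ} →
  (∀ i j → D i j ≡ D′ i j) → IsDistanceMatrix D → IsDistanceMatrix D′
IsDistanceMatrix-resp D≗D′ (diagonal , positive , symmetric , triangle) =
  (λ i → trans (sym (D≗D′ i i)) (diagonal i)) ,
  (λ i j i≢j → subst (0 <_) (D≗D′ i j) (positive i j i≢j)) ,
  (λ i j → trans (sym (D≗D′ i j)) (trans (symmetric i j) (D≗D′ j i))) ,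
  (λ i j w → subst₂ _≤_ (D≗D′ i j) (cong₂ _+_ (D≗D′ i w) (D≗D′ w j)) (triangle i j w))

module _ {V : Set} (D : V → V → ℕ) (h : V → ℕ) where

  cone : Maybe V → Maybe V → ℕ
  cone (just u) (just v) = D u v
  cone (just u) nothing  = h u
  cone nothing  (just v) = h v
  cone nothing  nothing  = 0

  cone-isDistanceMatrix : IsDistanceMatrix D → (∀ u → 0 < h u) →
    (∀ u w → h u ≤ D u w + h w) → (∀ u v → D u v ≤ h u + h v) →
    IsDistanceMatrix cone
  cone-isDistanceMatrix (diagonal , positive , symmetric , triangle) h-pos h-lipschitz D≤h+h =
    diagonal′ , positive′ , symmetric′ , triangle′
    where
    diagonal′ : ∀ i → cone i i ≡ 0
    diagonal′ (just u) = diagonal u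
    diagonal′ nothing  = refl

    positive′ : ∀ i j → ¬ i ≡ j → 0 < cone i j
    positive′ (just u) (just v) i≢j = positive u v (λ u≡v → i≢j (cong just u≡v))
    positive′ (just u) nothing  _   = h-pos u
    positive′ nothing  (just v) _   = h-pos v
    positive′ nothing  nothing  i≢j = ⊥-elim (i≢j refl)

    symmetric′ : ∀ i j → cone i j ≡ cone j i
    symmetric′ (just u) (just v) = symmetric u v
    symmetric′ (just u) nothing  = refl
    symmetric′ nothing  (just v) = refl
    symmetric′ nothing  nothing  = refl

    triangle′ : ∀ i j w → cone i j ≤ cone i w + cone w j
    triangle′ (just u) (just v) (just w) = triangle u v w
    triangle′ (just u) (just v) nothing  = D≤h+h u v
    triangle′ (just u) nothing  (just w) = h-lipschitz u w
    triangle′ (just u) nothing  nothing  = m≤m+n (h u) 0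
    triangle′ nothing  (just v) (just w) = begin
      h v           ≤⟨ h-lipschitz v w ⟩
      D v w + h w   ≡⟨ cong (_+ h w) (symmetric v w) ⟩
      D w v + h w   ≡⟨ +-comm (D w v) (h w) ⟩
      h w + D w v   ∎
      where open ≤-Reasoning
    triangle′ nothing  (just v) nothing  = ≤-refl
    triangle′ nothing  nothing  _        = z≤n

module GadgetDistances {nc : ℕ} (G : SimpleGraph nc) where
  open SimpleGraph G
  open Gadget G

  AdjG-sym : Symmetric AdjG
  AdjG-sym = swap

  orig-walk≤3-< : ∀ i j → Lt i j → ∃[ k ] k ≤ 3 × Walk AdjG (orig i) (orig j) k
  orig-walk≤3-< i j i<j with adj i j in eq
  ... | true  = 3 , ≤-refl ,
    cons (inj₁ (e-in i j i<j q)) (cons (inj₁ (e-mid i j i<j q)) (cons (inj₁ (e-out i j i<j q)) nil))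
    where
    q : T (adj i j)
    q = Equivalence.from T-≡ eq
  ... | false = 2 , n≤1+n 2 , cons (inj₁ (m-in i j i<j q)) (cons (inj₁ (m-out i j i<j q)) nil)
    where
    q : T (not (adj i j))
    q = Equivalence.from T-not-≡ eq

  orig-walk≤3 : ∀ i j → ∃[ k ] k ≤ 3 × Walk AdjG (orig i) (orig j) k
  orig-walk≤3 i j with <-cmp (toℕ i) (toℕ j)
  ... | tri< i<j _ _ = orig-walk≤3-< i j (<⇒<ᵇ i<j)
  ... | tri> _ _ j<i with orig-walk≤3-< j i (<⇒<ᵇ j<i)
  ...   | k , k≤3 , p = k , k≤3 , reverse AdjG-sym p
  orig-walk≤3 i j | tri≈ _ i≡j _ with toℕ-injective i≡j
  ...   | refl = 0 , z≤n , nil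

  depth : GV → ℕ
  depth u = if isOrig u then 0 else 1

  height : GV → ℕ
  height u = if isOrig u then 2 else 3

  height≡2+depth : ∀ u → height u ≡ 2 + depth u
  height≡2+depth u with isOrig u
  ... | true  = refl
  ... | false = refl

  height≤3 : ∀ u → height u ≤ 3
  height≤3 u with isOrig u
  ... | true  = n≤1+n 2
  ... | false = ≤-refl

  2≤height : ∀ u → 2 ≤ height u
  2≤height u = subst (2 ≤_) (sym (height≡2+depth u)) (m≤m+n 2 (depth u))

  height-pos : ∀ u → 0 < height u
  height-pos u = ≤-trans (s≤s z≤n) (2≤height u)

  anchor : ∀ u → ∃[ a ] Walk AdjG (orig a) u (depth u)
  anchor (orig i)       = i , nil
  anchor (sub₁ i j p q) = i , cons (inj₁ (e-in i j p q)) nil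
  anchor (sub₂ i j p q) = j , cons (inj₂ (e-out i j p q)) nil
  anchor (mid i j p q)  = i , cons (inj₁ (m-in i j p q)) nil

  height-lipschitz : ∀ {u w k} → Walk AdjG u w k → height u ≤ k + height w
  height-lipschitz nil = ≤-refl
  height-lipschitz {u} {w} (cons _ _) =
    ≤-trans (height≤3 u) (+-mono-≤ (s≤s z≤n) (2≤height w))

  walk≤height+height : ∀ u v → ∃[ k ] k ≤ height u + height v × Walk AdjG u v k
  walk≤height+height u v with anchor u | anchor v
  ... | a , a⇝u | b , b⇝v with orig-walk≤3 a b
  ...   | k , k≤3 , a⇝b =
    depth u + (k + depth v) , length-bound , reverse AdjG-sym a⇝u ++ a⇝b ++ b⇝v
    where
    length-bound : depth u + (k + depth v) ≤ height u + height v
    length-bound = begin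
      depth u + (k + depth v)       ≤⟨ +-monoʳ-≤ (depth u) (+-monoˡ-≤ (depth v) k≤4) ⟩
      depth u + (4 + depth v)       ≡⟨ +-suc (depth u) (3 + depth v) ⟩
      1 + depth u + (3 + depth v)   ≡⟨ cong suc (+-suc (depth u) (2 + depth v)) ⟩
      2 + depth u + (2 + depth v)   ≡⟨ sym (cong₂ _+_ (height≡2+depth u) (height≡2+depth v)) ⟩
      height u + height v           ∎
      where
      open ≤-Reasoning
      k≤4 : k ≤ 4
      k≤4 = ≤-trans k≤3 (n≤1+n 3)

  cone≗Dmat : ∀ d i j → cone d height i j ≡ Dmat d i j
  cone≗Dmat d (just u) (just v) = refl
  cone≗Dmat d (just u) nothing  = refl
  cone≗Dmat d nothing  (just v) = refl
  cone≗Dmat d nothing  nothing  = refl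

proposition14 : {nc : ℕ} (G : SimpleGraph nc) → Connected G →
    (d : Gadget.GV G → Gadget.GV G → ℕ) →
    IsShortestPathDistance (Gadget.AdjG G) d →
    IsDistanceMatrix (Gadget.Dmat G d)
proposition14 G _ d sp =
  IsDistanceMatrix-resp (cone≗Dmat d)
    (cone-isDistanceMatrix d height (isDistanceMatrix AdjG-sym)
      height-pos height-lipschitz′ d≤height+height)
  where
  open GadgetDistances G
  open ShortestPath sp

  height-lipschitz′ : ∀ u w → height u ≤ d u w + height w
  height-lipschitz′ u w = height-lipschitz (geodesic u w)

  d≤height+height : ∀ u v → d u v ≤ height u + height v
  d≤height+height u v =
    let _ , k≤height+height , u⇝v = walk≤height+height u v
    in  ≤-trans (shortest u⇝v) k≤height+height
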